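{- Let $n,k,x,s,t$ be positive integers with $n\ge k+x$ and $k,x\ge t$. Let $\mathcal F\subseteq\genfrac{[}{]}{0pt}{}{V}{k}$, let $X$ be a $t$-cover of $\mathcal F$ with $\dim X=x$, and let $S\in\genfrac{[}{]}{0pt}{}{V}{s}$. If $\dim(X\cap S)=y<t$, then there exists $R\in\genfrac{[}{]}{0pt}{}{V}{s+t-y}$ with $S\subseteq R$ and $$|\mathcal F_S|\le \genfrac{[}{]}{0pt}{}{x-t+1}{1}_q^{\,t-y}\,|\mathcal F_R|.$$
   Context: Let $q$ be a prime power and $V$ an $n$-dimensional vector space over $\mathbb F_q$; $\genfrac{[}{]}{0pt}{}{V}{j}$ denotes the set of $j$-dimensional subspaces of $V$. The Gaussian binomial coefficient is $\genfrac{[}{]}{0pt}{}{m}{i}_q=\prod_{0\le j<i}\frac{q^{m-j}-1}{q^{i-j}-1}$, with $\genfrac{[}{]}{0pt}{}{m}{0}_q=1$ and $\genfrac{[}{]}{0pt}{}{m}{c}_q=0$ for negative $c$. A subspace $X$ of $V$ is a $t$-cover of $\mathcal F$ if $\dim(X\cap F)\ge t$ for every $F\in\mathcal F$. For a subspace $S$, $\mathcal F_S=\{F\in\mathcal F: S\subseteq F\}$. -}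

module Defs where

open import Data.Nat using (ℕ; zero; suc; _^_; _≤_)
import Data.Nat as N
open import Data.Bool using (Bool; true; false; _∧_)
import Data.Bool.Properties as BP
import Data.Bool.Base as BB
import Data.Vec.Relation.Unary.All as VAll
open import Data.Product using (Σ; _×_; _,_; proj₁; proj₂; ∃; ∃-syntax)
open import Data.List as L using (List; []; _∷_; length; filter; concatMap)
open import Data.List.Membership.Propositional using (_∈_)
open import Data.List.Membership.Propositional.Properties using (∈-concatMap⁺; ∈-map⁺)
open import Data.List.Relation.Unary.All as All using (All; all?)
open import Data.List.Relation.Unary.Any using (Any; here; there)
import Data.List.Relation.Unary.Any as Any
open import Data.List.Relation.Unary.AllPairs using (AllPairs)
open import Data.List.Relation.Unary.Unique.Propositional using (Unique)
open import Data.Vec as V using (Vec; []; _∷_)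
open import Relation.Binary.PropositionalEquality using (_≡_; _≢_; refl; cong; cong₂)
open import Relation.Binary.Definitions using (DecidableEquality)
open import Relation.Nullary using (Dec; yes; no; ¬_)
open import Algebra.Structures using (IsCommutativeRing)

∧-intro : ∀ {a b} → a ≡ true → b ≡ true → (a ∧ b) ≡ true
∧-intro refl refl = refl

∧-left : ∀ {a b} → (a ∧ b) ≡ true → a ≡ true
∧-left {true} _ = refl

∧-right : ∀ {a b} → (a ∧ b) ≡ true → b ≡ true
∧-right {true} p = p

-- A finite field F_q.  (Any finite field has prime-power order, so the
-- standing assumption "q is a prime power" is the statement that q is the
-- number of elements of such a field.)

record FiniteField : Set₁ where
  infixl 6 _+_
  infixl 7 _*_
  field
    F      : Set
    _≟_    : DecidableEquality F
    0# 1#  : F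
    _+_ _*_ : F → F → F
    -_     : F → F
    isCommutativeRing : IsCommutativeRing _≡_ _+_ _*_ -_ 0# 1#
    0≢1    : 0# ≢ 1#
    inverse : ∀ a → a ≢ 0# → Σ F λ b → a * b ≡ 1#
    elems  : List F
    elems-complete : ∀ a → a ∈ elems
    elems-unique   : Unique elems

  q : ℕ
  q = length elems

-- Gaussian binomial coefficient, via the q-Pascal recursion
--   [m+1, i+1]_q = [m, i]_q + q^(i+1) [m, i+1]_q ,  [m,0]_q = 1, [0,i+1]_q = 0
-- (equal to the product formula of the paper).

gauss : ℕ → ℕ → ℕ → ℕ
gauss q m       zero    = 1
gauss q zero    (suc i) = 0
gauss q (suc m) (suc i) = gauss q m i N.+ q ^ suc i N.* gauss q m (suc i)

module Space (𝔽 : FiniteField) (n : ℕ) where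
  open FiniteField 𝔽

  Vect : Set
  Vect = Vec F n

  0v : Vect
  0v = V.replicate n 0#

  _⊕_ : Vect → Vect → Vect
  u ⊕ v = V.zipWith _+_ u v

  _·_ : F → Vect → Vect
  c · v = V.map (c *_) v

  allVecs : (m : ℕ) → List (Vec F m)
  allVecs zero    = [] ∷ []
  allVecs (suc m) = concatMap (λ a → L.map (a ∷_) (allVecs m)) elems

  allVecs-complete : ∀ {m} (v : Vec F m) → v ∈ allVecs m
  allVecs-complete []      = here refl
  allVecs-complete (a ∷ v) =
    ∈-concatMap⁺ (λ b → L.map (b ∷_) (allVecs _)) (Any.map (λ { refl → ∈-map⁺ (a ∷_) (allVecs-complete v) })
                          (elems-complete a))

  record Subspace : Set where
    field
      mem    : Vect → Bool
      0∈     : mem 0v ≡ true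
      +-closed : ∀ u v → mem u ≡ true → mem v ≡ true → mem (u ⊕ v) ≡ true
      ·-closed : ∀ c v → mem v ≡ true → mem (c · v) ≡ true
  open Subspace public

  _∈ₛ_ : Vect → Subspace → Set
  v ∈ₛ U = mem U v ≡ true

  _⊆_ : Subspace → Subspace → Set
  U ⊆ W = ∀ v → v ∈ₛ U → v ∈ₛ W

  _≐_ : Subspace → Subspace → Set
  U ≐ W = ∀ v → mem U v ≡ mem W v

  _∩_ : Subspace → Subspace → Subspace
  U ∩ W = record
    { mem = λ v → mem U v ∧ mem W v
    ; 0∈ = ∧-intro (0∈ U) (0∈ W)
    ; +-closed = λ u v p r →
        ∧-intro (+-closed U u v (∧-left p) (∧-left r))
                (+-closed W u v (∧-right p) (∧-right r))
    ; ·-closed = λ c v p →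
        ∧-intro (·-closed U c v (∧-left p))
                (·-closed W c v (∧-right p))
    }

  lincomb : ∀ {d} → Vec F d → Vec Vect d → Vect
  lincomb []       []       = 0v
  lincomb (c ∷ cs) (v ∷ vs) = (c · v) ⊕ lincomb cs vs

  LinIndep : ∀ {d} → Vec Vect d → Set
  LinIndep {d} vs = ∀ cs → lincomb cs vs ≡ 0v → cs ≡ V.replicate d 0#

  HasDim : Subspace → ℕ → Set
  HasDim U d = Σ (Vec Vect d) λ b →
      VAll.All (_∈ₛ U) b
    × LinIndep b
    × (∀ v → v ∈ₛ U → ∃[ cs ] lincomb cs b ≡ v)

  DimAtLeast : Subspace → ℕ → Set
  DimAtLeast U t = ∃[ d ] (t ≤ d × HasDim U d)

  IsCover : ℕ → Subspace → List Subspace → Set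
  IsCover t X 𝓕 = All.All (λ G → DimAtLeast (X ∩ G) t) 𝓕

  _⊆?_ : (U W : Subspace) → Dec (U ⊆ W)
  U ⊆? W with all? (λ v → mem U v BP.≤? mem W v) (allVecs n)
  ... | yes p = yes λ v v∈U → leTrue (All.lookup p (allVecs-complete v)) v∈U
    where
      leTrue : ∀ {a b} → a BB.≤ b → a ≡ true → b ≡ true
      leTrue BB.b≤b refl = refl
  ... | no ¬p = no λ U⊆W → ¬p (All.tabulate λ {v} _ → le (mem U v) (mem W v) (U⊆W v))
    where
      le : ∀ a b → (a ≡ true → b ≡ true) → a BB.≤ b
      le false false _ = BB.b≤b
      le false true  _ = BB.f≤t
      le true  b     f with f refl
      ... | refl = BB.b≤b

  -- a family of subspaces, represented as a duplicate-free list
  Distinct : List Subspace → Set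
  Distinct = AllPairs (λ U W → ¬ (U ≐ W))

  countContaining : List Subspace → Subspace → ℕ
  countContaining 𝓕 S = length (filter (S ⊆?_) 𝓕)

-- Extend a basis e of X ∩ S to a basis c₁ ++ c₂ ++ e of X with |c₁| = x - t + 1. Then
-- W = ⟨c₁⟩ meets S trivially and X = W ⊕ ⟨c₂ ++ e⟩ with dim ⟨c₂ ++ e⟩ = t - 1, so every
-- F ∈ 𝓕 containing S, which meets X in dimension at least t, contains a nonzero w ∈ W and
-- hence ⟨w, S⟩. The [x - t + 1, 1]_q points of W thus give spaces ⟨w, S⟩ covering 𝓕_S, and
-- the one lying in the most members is an R with |𝓕_S| ≤ [x - t + 1, 1]_q |𝓕_R|,
-- dim R = s + 1 and dim (X ∩ R) = y + 1. Repeating this t - y times proves the bound.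

{-# OPTIONS --safe #-}
module Submission where

open import Defs
open import Data.Nat as ℕ using (ℕ; zero; suc; _^_; _∸_; _≤_; _<_; z≤n; s≤s)
import Data.Nat.Properties as ℕₚ
open import Data.Nat.ListAction using (sum)
open import Data.Product using (∃; ∃₂; ∃-syntax; _×_; _,_; proj₁; proj₂)
open import Data.Sum using (_⊎_; inj₁; inj₂; [_,_]′)
open import Data.Empty using (⊥-elim)
open import Data.Bool using (true)
open import Function using (_∘_)
open import Data.List as L
  using (List; []; _∷_; [_]; _++_; length; map; replicate; filter; cartesianProductWith)
import Data.List.Properties as Lₚ
open import Data.List.Relation.Unary.All as All using (All; []; _∷_)
import Data.List.Relation.Unary.All.Properties as Allₚ
open import Data.List.Relation.Unary.Any as Any using (Any; here; there; any?)
import Data.List.Relation.Unary.Any.Properties as Anyₚ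
open import Data.List.Membership.Propositional using (_∈_)
open import Data.List.Membership.Propositional.Properties
  using (∈-cartesianProductWith⁺; ∈-cartesianProductWith⁻)
open import Data.List.Extrema.Nat using (argmax; argmax-all; f[⊥]≤f[argmax]; f[xs]≤f[argmax])
open import Data.Vec as V using (Vec; []; _∷_)
import Data.Vec.Properties as Vₚ
import Data.Vec.Relation.Unary.All.Properties as VAllₚ
open import Relation.Binary.PropositionalEquality
  using (_≡_; _≢_; refl; sym; trans; cong; cong₂; subst; isEquivalence; module ≡-Reasoning)
open import Relation.Nullary using (Dec; yes; no; ¬_; does)
open import Relation.Unary using (Decidable)
open import Algebra.Structures using (IsCommutativeRing)
open import Algebra.Bundles using (AbelianGroup; CommutativeRing)
import Algebra.Properties.AbelianGroup as AbelianGroupProperties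
import Algebra.Properties.CommutativeSemigroup as CommutativeSemigroupProperties
import Algebra.Properties.Ring as RingProperties
open import Data.Nat.Tactic.RingSolver using (solve-∀)

length-cartesianProductWith : ∀ {A B C : Set} (f : A → B → C) xs ys →
  length (cartesianProductWith f xs ys) ≡ length xs ℕ.* length ys
length-cartesianProductWith f []       ys = refl
length-cartesianProductWith f (x ∷ xs) ys = trans (Lₚ.length-++ (map (f x) ys))
  (cong₂ ℕ._+_ (Lₚ.length-map (f x) ys) (length-cartesianProductWith f xs ys))

++-split : ∀ {A : Set} (zs : List A) m k → length zs ≡ m ℕ.+ k →
           ∃₂ λ xs ys → zs ≡ xs ++ ys × length xs ≡ m × length ys ≡ k
++-split zs       zero    k e = [] , zs , refl , refl , e
++-split (z ∷ zs) (suc m) k e with ++-split zs m k (ℕₚ.suc-injective e)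
... | xs , ys , refl , refl , ys-length = z ∷ xs , ys , refl , refl , ys-length

module Counting where
  open import Data.Nat using (_+_; _*_)

  private variable A B : Set

  sum-map-+ : ∀ (f g : B → ℕ) bs → sum (map (λ b → f b + g b) bs) ≡ sum (map f bs) + sum (map g bs)
  sum-map-+ f g []       = refl
  sum-map-+ f g (b ∷ bs) =
    trans (cong (f b + g b +_) (sum-map-+ f g bs)) (+-interchange (f b) (g b) _ _)
    where
    open CommutativeSemigroupProperties ℕₚ.+-commutativeSemigroup renaming (interchange to +-interchange)

  sum-map-≤ : ∀ (f : B → ℕ) {M} bs → All (λ b → f b ≤ M) bs → sum (map f bs) ≤ length bs * M
  sum-map-≤ f []       []         = z≤n
  sum-map-≤ f (b ∷ bs) (fb≤ ∷ fbs≤) = ℕₚ.+-mono-≤ fb≤ (sum-map-≤ f bs fbs≤)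

  sum-map-≤-length*max : ∀ (f : B → ℕ) {P : B → Set} {bs} → All P bs → 0 < length bs →
                         ∃ λ b → P b × sum (map f bs) ≤ length bs * f b
  sum-map-≤-length*max f {bs = b₀ ∷ bs} (p₀ ∷ ps) _ =
    argmax f b₀ bs , argmax-all f p₀ ps ,
    sum-map-≤ f (b₀ ∷ bs) (f[⊥]≤f[argmax] {f = f} b₀ bs ∷ f[xs]≤f[argmax] {f = f} b₀ bs)

  double-counting : ∀ {P : A → Set} {Q : B → A → Set} (P? : Decidable P) (Q? : ∀ b → Decidable (Q b))
    bs xs → All (λ a → P a → Any (λ b → Q b a) bs) xs →
    length (filter P? xs) ≤ sum (map (λ b → length (filter (Q? b) xs)) bs)
  double-counting P? Q? bs []       []               = z≤n
  double-counting {Q = Q} P? Q? bs (a ∷ xs) (covered ∷ covers) = begin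
    length (filter P? ([ a ] L.++ xs))
      ≡⟨ count-++ P? ⟩
    length (filter P? [ a ]) + length (filter P? xs)
      ≤⟨ ℕₚ.+-mono-≤ count-a (double-counting P? Q? bs xs covers) ⟩
    sum (map (λ b → length (filter (Q? b) [ a ])) bs) + sum (map (λ b → length (filter (Q? b) xs)) bs)
      ≡⟨ sym (sum-map-+ _ _ bs) ⟩
    sum (map (λ b → length (filter (Q? b) [ a ]) + length (filter (Q? b) xs)) bs)
      ≡⟨ cong sum (Lₚ.map-cong (λ b → sym (count-++ (Q? b))) bs) ⟩
    sum (map (λ b → length (filter (Q? b) (a ∷ xs))) bs) ∎
    where
    open ℕₚ.≤-Reasoning
    count-++ : ∀ {R} (R? : Decidable R) →
               length (filter R? ([ a ] L.++ xs)) ≡ length (filter R? [ a ]) + length (filter R? xs)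
    count-++ R? = trans (cong length (Lₚ.filter-++ R? [ a ] xs)) (Lₚ.length-++ (filter R? [ a ]))
    one≤ : ∀ {bs} → Any (λ b → Q b a) bs → 1 ≤ sum (map (λ b → length (filter (Q? b) [ a ])) bs)
    one≤         (here q)  = ℕₚ.≤-trans (Lₚ.filter-some (Q? _) (here q)) (ℕₚ.m≤m+n _ _)
    one≤ {b ∷ _} (there p) = ℕₚ.≤-trans (one≤ p) (ℕₚ.m≤n+m _ (length (filter (Q? b) [ a ])))
    count-a : length (filter P? [ a ]) ≤ sum (map (λ b → length (filter (Q? b) [ a ])) bs)
    count-a with P? a
    ... | yes p = one≤ (covered p)
    ... | no  _ = z≤n

module Scalars (𝔽 : FiniteField) where
  open FiniteField 𝔽
  open IsCommutativeRing isCommutativeRing using (*-comm; *-assoc; *-identityˡ; *-identityʳ; zeroʳ)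
  open ≡-Reasoning

  commutativeRing : CommutativeRing _ _
  commutativeRing = record { isCommutativeRing = isCommutativeRing }

  inverseˡ : ∀ {a} → a ≢ 0# → ∃ λ b → b * a ≡ 1#
  inverseˡ {a} a≢0 with inverse a a≢0
  ... | b , ab≡1 = b , trans (*-comm b a) ab≡1

  1≢0 : 1# ≢ 0#
  1≢0 1≡0 = 0≢1 (sym 1≡0)

  NonTrivial : List F → Set
  NonTrivial = Any (_≢ 0#)

  trivial-or-nonTrivial : ∀ cs → All (_≡ 0#) cs ⊎ NonTrivial cs
  trivial-or-nonTrivial []       = inj₁ []
  trivial-or-nonTrivial (c ∷ cs) with c ≟ 0# | trivial-or-nonTrivial cs
  ... | no c≢0  | _        = inj₂ (here c≢0)
  ... | yes c≡0 | inj₁ zs  = inj₁ (c≡0 ∷ zs)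
  ... | yes _   | inj₂ nz  = inj₂ (there nz)

  trivial⇒¬nonTrivial : ∀ {cs} → All (_≡ 0#) cs → ¬ NonTrivial cs
  trivial⇒¬nonTrivial zs = Allₚ.All¬⇒¬Any (All.map (λ c≡0 c≢0 → c≢0 c≡0) zs)

  -- One representative of each 1-dimensional subspace of F^m: the vectors whose last
  -- nonzero entry is 1.
  points : ℕ → List (List F)
  points zero    = []
  points (suc m) = (1# ∷ replicate m 0#) ∷ cartesianProductWith _∷_ elems (points m)

  length-points : ∀ m → length (points m) ≡ gauss q m 1
  length-points zero    = refl
  length-points (suc m) = cong suc (begin
    length (cartesianProductWith _∷_ elems (points m))
      ≡⟨ length-cartesianProductWith _∷_ elems (points m) ⟩
    q ℕ.* length (points m)
      ≡⟨ cong (q ℕ.*_) (length-points m) ⟩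
    q ℕ.* gauss q m 1
      ≡⟨ cong (ℕ._* gauss q m 1) (sym (ℕₚ.*-identityʳ q)) ⟩
    q ℕ.^ 1 ℕ.* gauss q m 1 ∎)

  points-nonTrivial : ∀ m → All (λ β → length β ≡ m × NonTrivial β) (points m)
  points-nonTrivial zero    = []
  points-nonTrivial (suc m) = (cong suc (Lₚ.length-replicate m) , here 1≢0)
                            ∷ All.tabulate cons
    where
    cons : ∀ {β} → β ∈ cartesianProductWith _∷_ elems (points m) → length β ≡ suc m × NonTrivial β
    cons β∈ with ∈-cartesianProductWith⁻ _∷_ elems (points m) β∈
    ... | _ , _ , _ , β∈points , refl with All.lookup (points-nonTrivial m) β∈points
    ...   | len , nz = cong suc len , there nz

  private
    scaled-zeros : ∀ a {cs} → All (_≡ 0#) cs → cs ≡ map (a *_) (replicate (length cs) 0#)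
    scaled-zeros a []          = refl
    scaled-zeros a (refl ∷ zs) = cong₂ _∷_ (sym (zeroʳ a)) (scaled-zeros a zs)

  normalise : ∀ β → NonTrivial β →
              ∃₂ λ l β′ → l ≢ 0# × β′ ∈ points (length β) × β ≡ map (l *_) β′
  normalise (a ∷ β) nz with trivial-or-nonTrivial β
  normalise (a ∷ β) (here a≢0)  | inj₁ zs = a , 1# ∷ replicate (length β) 0# , a≢0 , here refl ,
                                            cong₂ _∷_ (sym (*-identityʳ a)) (scaled-zeros a zs)
  normalise (a ∷ β) (there nz) | inj₁ zs = ⊥-elim (trivial⇒¬nonTrivial zs nz)
  normalise (a ∷ β) _          | inj₂ nz with normalise β nz
  ... | l , β′ , l≢0 , β′∈ , refl = l , (b * a) ∷ β′ , l≢0 ,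
        there (∈-cartesianProductWith⁺ _∷_ (elems-complete (b * a)) β′∈) , cong (_∷ _) (sym l[ba]≡a)
    where
    b = proj₁ (inverseˡ l≢0)
    l[ba]≡a : l * (b * a) ≡ a
    l[ba]≡a = begin
      l * (b * a)  ≡⟨ sym (*-assoc l b a) ⟩
      (l * b) * a  ≡⟨ cong (_* a) (trans (*-comm l b) (proj₂ (inverseˡ l≢0))) ⟩
      1# * a       ≡⟨ *-identityˡ a ⟩
      a            ∎

module Vectors (𝔽 : FiniteField) where
  open FiniteField 𝔽
  open IsCommutativeRing isCommutativeRing hiding (refl; sym; trans; isEquivalence)

  private variable m : ℕ

  infixl 6 _⊕_
  infixr 7 _·_

  -- The operations of Space 𝔽 n, for vectors of any length; they agree definitionally.
  _⊕_ : Vec F m → Vec F m → Vec F m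
  _⊕_ = V.zipWith _+_

  _·_ : F → Vec F m → Vec F m
  c · v = V.map (c *_) v

  0v : Vec F m
  0v = V.replicate _ 0#

  ⊖_ : Vec F m → Vec F m
  ⊖ v = V.map (λ a → - a) v

  ⊕-comm : ∀ (u v : Vec F m) → u ⊕ v ≡ v ⊕ u
  ⊕-comm []      []      = refl
  ⊕-comm (a ∷ u) (b ∷ v) = cong₂ _∷_ (+-comm a b) (⊕-comm u v)

  ⊕-assoc : ∀ (u v w : Vec F m) → (u ⊕ v) ⊕ w ≡ u ⊕ (v ⊕ w)
  ⊕-assoc []      []      []      = refl
  ⊕-assoc (a ∷ u) (b ∷ v) (c ∷ w) = cong₂ _∷_ (+-assoc a b c) (⊕-assoc u v w)

  ⊕-identityˡ : ∀ (v : Vec F m) → 0v ⊕ v ≡ v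
  ⊕-identityˡ []      = refl
  ⊕-identityˡ (a ∷ v) = cong₂ _∷_ (+-identityˡ a) (⊕-identityˡ v)

  ⊕-identityʳ : ∀ (v : Vec F m) → v ⊕ 0v ≡ v
  ⊕-identityʳ v = trans (⊕-comm v 0v) (⊕-identityˡ v)

  ⊖-inverseˡ : ∀ (v : Vec F m) → ⊖ v ⊕ v ≡ 0v
  ⊖-inverseˡ []      = refl
  ⊖-inverseˡ (a ∷ v) = cong₂ _∷_ (-‿inverseˡ a) (⊖-inverseˡ v)

  ·-distribˡ : ∀ c (u v : Vec F m) → c · (u ⊕ v) ≡ c · u ⊕ c · v
  ·-distribˡ c []      []      = refl
  ·-distribˡ c (a ∷ u) (b ∷ v) = cong₂ _∷_ (distribˡ c a b) (·-distribˡ c u v)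

  ·-distribʳ : ∀ a b (v : Vec F m) → (a + b) · v ≡ a · v ⊕ b · v
  ·-distribʳ a b []      = refl
  ·-distribʳ a b (c ∷ v) = cong₂ _∷_ (distribʳ c a b) (·-distribʳ a b v)

  ·-assoc : ∀ a b (v : Vec F m) → (a * b) · v ≡ a · (b · v)
  ·-assoc a b []      = refl
  ·-assoc a b (c ∷ v) = cong₂ _∷_ (*-assoc a b c) (·-assoc a b v)

  ·-zeroˡ : ∀ (v : Vec F m) → 0# · v ≡ 0v
  ·-zeroˡ []      = refl
  ·-zeroˡ (a ∷ v) = cong₂ _∷_ (zeroˡ a) (·-zeroˡ v)

  ·-zeroʳ : ∀ c → c · 0v {m} ≡ 0v
  ·-zeroʳ {zero}  c = refl
  ·-zeroʳ {suc m} c = cong₂ _∷_ (zeroʳ c) (·-zeroʳ c)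

  ·-identityˡ : ∀ (v : Vec F m) → 1# · v ≡ v
  ·-identityˡ []      = refl
  ·-identityˡ (a ∷ v) = cong₂ _∷_ (*-identityˡ a) (·-identityˡ v)

  ⊖-inverseʳ : ∀ (v : Vec F m) → v ⊕ ⊖ v ≡ 0v
  ⊖-inverseʳ v = trans (⊕-comm v (⊖ v)) (⊖-inverseˡ v)

  ⊕-abelianGroup : ℕ → AbelianGroup _ _
  ⊕-abelianGroup m = record
    { Carrier = Vec F m ; _≈_ = _≡_ ; _∙_ = _⊕_ ; ε = 0v ; _⁻¹ = ⊖_
    ; isAbelianGroup = record
      { isGroup = record
        { isMonoid = record
          { isSemigroup = record
            { isMagma = record { isEquivalence = isEquivalence ; ∙-cong = cong₂ _⊕_ }
            ; assoc = ⊕-assoc }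
          ; identity = ⊕-identityˡ , ⊕-identityʳ }
        ; inverse = ⊖-inverseˡ , ⊖-inverseʳ
        ; ⁻¹-cong = cong ⊖_ }
      ; comm = ⊕-comm } }

  ⊕-interchange : ∀ (a b c d : Vec F m) → (a ⊕ b) ⊕ (c ⊕ d) ≡ (a ⊕ c) ⊕ (b ⊕ d)
  ⊕-interchange {m} =
    CommutativeSemigroupProperties.interchange (AbelianGroup.commutativeSemigroup (⊕-abelianGroup m))

  -‿·-distrib : ∀ a (v : Vec F m) → (- a) · v ≡ ⊖ (a · v)
  -‿·-distrib a []      = refl
  -‿·-distrib a (b ∷ v) = cong₂ _∷_ (sym (-‿distribˡ-* a b)) (-‿·-distrib a v)
    where open RingProperties (CommutativeRing.ring (Scalars.commutativeRing 𝔽)) using (-‿distribˡ-*)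

  -1·v≡⊖v : ∀ (v : Vec F m) → (- 1#) · v ≡ ⊖ v
  -1·v≡⊖v v = trans (-‿·-distrib 1# v) (cong ⊖_ (·-identityˡ v))

  ·-cancel : ∀ {a b} → b * a ≡ 1# → ∀ (v : Vec F m) → b · (a · v) ≡ v
  ·-cancel {a = a} {b} ba≡1 v = begin
    b · (a · v)  ≡⟨ sym (·-assoc b a v) ⟩
    (b * a) · v  ≡⟨ cong (_· v) ba≡1 ⟩
    1# · v       ≡⟨ ·-identityˡ v ⟩
    v            ∎
    where open ≡-Reasoning

module Combinations (𝔽 : FiniteField) (n : ℕ) where
  open FiniteField 𝔽
  open IsCommutativeRing isCommutativeRing using (*-comm; *-assoc; *-identityʳ; -‿inverseʳ)
  open Scalars 𝔽
  open Vectors 𝔽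
  open Space 𝔽 n
    using ( Vect; Subspace; 0∈; +-closed; ·-closed; _∈ₛ_; _⊆_; _∩_; HasDim; LinIndep; lincomb
          ; allVecs; allVecs-complete)
  open RingProperties (CommutativeRing.ring commutativeRing) using (-‿distribˡ-*)
  open AbelianGroupProperties (⊕-abelianGroup n) using (inverseˡ-unique; xyx⁻¹≈y)
  open ≡-Reasoning

  -- Surplus coefficients or vectors are ignored.
  lc : List F → List Vect → Vect
  lc (c ∷ cs) (v ∷ vs) = c · v ⊕ lc cs vs
  lc _        _        = 0v

  lc-[] : ∀ cs → lc cs [] ≡ 0v
  lc-[] []       = refl
  lc-[] (_ ∷ _)  = refl

  lc-zeros : ∀ {cs} L → All (_≡ 0#) cs → lc cs L ≡ 0v
  lc-zeros L       []           = refl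
  lc-zeros []      (_ ∷ _)      = refl
  lc-zeros (v ∷ L) (refl ∷ zs) =
    trans (cong₂ _⊕_ (·-zeroˡ v) (lc-zeros L zs)) (⊕-identityˡ 0v)

  _+ᶜ_ : List F → List F → List F
  (c ∷ cs) +ᶜ (d ∷ ds) = (c + d) ∷ (cs +ᶜ ds)
  []       +ᶜ ds       = ds
  cs       +ᶜ []       = cs

  lc-+ᶜ : ∀ cs ds L → lc (cs +ᶜ ds) L ≡ lc cs L ⊕ lc ds L
  lc-+ᶜ []       ds       L       = sym (⊕-identityˡ _)
  lc-+ᶜ (c ∷ cs) []       L       = sym (⊕-identityʳ _)
  lc-+ᶜ (c ∷ cs) (d ∷ ds) []      = sym (⊕-identityˡ _)
  lc-+ᶜ (c ∷ cs) (d ∷ ds) (v ∷ L) =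
    trans (cong₂ _⊕_ (·-distribʳ c d v) (lc-+ᶜ cs ds L)) (⊕-interchange _ _ _ _)

  lc-scale : ∀ a cs L → lc (map (a *_) cs) L ≡ a · lc cs L
  lc-scale a []       L       = sym (·-zeroʳ a)
  lc-scale a (c ∷ cs) []      = sym (·-zeroʳ a)
  lc-scale a (c ∷ cs) (v ∷ L) =
    trans (cong₂ _⊕_ (·-assoc a c v) (lc-scale a cs L)) (sym (·-distribˡ a _ _))

  lc-++ : ∀ cs ds A B → length cs ≡ length A → lc (cs ++ ds) (A ++ B) ≡ lc cs A ⊕ lc ds B
  lc-++ []       ds []      B _ = sym (⊕-identityˡ _)
  lc-++ (c ∷ cs) ds (v ∷ A) B e =
    trans (cong (c · v ⊕_) (lc-++ cs ds A B (ℕₚ.suc-injective e))) (sym (⊕-assoc _ _ _))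

  lc-insert : ∀ cs c ds A v B → length cs ≡ length A →
              lc (cs ++ c ∷ ds) (A ++ v ∷ B) ≡ lc (cs ++ ds) (A ++ B) ⊕ c · v
  lc-insert cs c ds A v B e = begin
    lc (cs ++ c ∷ ds) (A ++ v ∷ B)  ≡⟨ lc-++ cs (c ∷ ds) A (v ∷ B) e ⟩
    lc cs A ⊕ (c · v ⊕ lc ds B)     ≡⟨ cong (lc cs A ⊕_) (⊕-comm _ _) ⟩
    lc cs A ⊕ (lc ds B ⊕ c · v)     ≡⟨ sym (⊕-assoc _ _ _) ⟩
    (lc cs A ⊕ lc ds B) ⊕ c · v     ≡⟨ cong (_⊕ c · v) (sym (lc-++ cs ds A B e)) ⟩
    lc (cs ++ ds) (A ++ B) ⊕ c · v  ∎

  record IsSubspace (U : Vect → Set) : Set where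
    field
      ∋0  : U 0v
      ∋-⊕ : ∀ {u v} → U u → U v → U (u ⊕ v)
      ∋-· : ∀ c {v} → U v → U (c · v)
  open IsSubspace public

  ∋-lc : ∀ {U} → IsSubspace U → ∀ cs {L} → All U L → U (lc cs L)
  ∋-lc U []       _        = ∋0 U
  ∋-lc U (c ∷ cs) []       = ∋0 U
  ∋-lc U (c ∷ cs) (u ∷ us) = ∋-⊕ U (∋-· U c u) (∋-lc U cs us)

  ∈ₛ-isSubspace : (W : Subspace) → IsSubspace (_∈ₛ W)
  ∈ₛ-isSubspace W = record
    { ∋0 = 0∈ W ; ∋-⊕ = +-closed W _ _ ; ∋-· = λ c → ·-closed W c _ }

  InSpan : List Vect → Vect → Set
  InSpan L v = ∃ λ cs → lc cs L ≡ v

  span-isSubspace : ∀ L → IsSubspace (InSpan L)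
  span-isSubspace L = record
    { ∋0  = [] , refl
    ; ∋-⊕ = λ { (cs , refl) (ds , refl) → cs +ᶜ ds , lc-+ᶜ cs ds L }
    ; ∋-· = λ { c (cs , refl) → map (c *_) cs , lc-scale c cs L } }

  span-minimal : ∀ {U L v} → IsSubspace U → All U L → InSpan L v → U v
  span-minimal U us (cs , refl) = ∋-lc U cs us

  inSpan-∷ : ∀ {L v} u → InSpan L v → InSpan (u ∷ L) v
  inSpan-∷ u (cs , refl) = 0# ∷ cs , trans (cong (_⊕ _) (·-zeroˡ u)) (⊕-identityˡ _)

  inSpan-++ : ∀ A {B v} → InSpan B v → InSpan (A ++ B) v
  inSpan-++ []      p = p
  inSpan-++ (u ∷ A) p = inSpan-∷ u (inSpan-++ A p)

  inSpan-head : ∀ v L → InSpan (v ∷ L) v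
  inSpan-head v L = 1# ∷ [] , trans (⊕-identityʳ _) (·-identityˡ v)

  generators-inSpan : ∀ L → All (InSpan L) L
  generators-inSpan []      = []
  generators-inSpan (v ∷ L) = inSpan-head v L ∷ All.map (inSpan-∷ v) (generators-inSpan L)

  resize : List F → (d : ℕ) → Vec F d
  resize cs       zero    = []
  resize []       (suc d) = 0# ∷ resize [] d
  resize (c ∷ cs) (suc d) = c ∷ resize cs d

  length-resize : ∀ cs d → length (V.toList (resize cs d)) ≡ d
  length-resize cs d = Vₚ.length-toList (resize cs d)

  lc-resize : ∀ cs L → lc (V.toList (resize cs (length L))) L ≡ lc cs L
  lc-resize cs       []      = sym (lc-[] cs)
  lc-resize []       (v ∷ L) = trans (cong₂ _⊕_ (·-zeroˡ v) (lc-resize [] L)) (⊕-identityˡ _)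
  lc-resize (c ∷ cs) (v ∷ L) = cong (c · v ⊕_) (lc-resize cs L)

  inSpan? : ∀ L v → Dec (InSpan L v)
  inSpan? L v with any? (λ cs → Vₚ.≡-dec _≟_ (lc (V.toList cs) L) v) (allVecs (length L))
  ... | yes p = yes (V.toList (proj₁ (Any.satisfied p)) , proj₂ (Any.satisfied p))
  ... | no ¬p = no λ { (cs , e) → ¬p (Any.map (λ { refl → trans (lc-resize cs L) e })
                                             (allVecs-complete (resize cs (length L)))) }

  private
    dec-true : ∀ {P : Set} (P? : Dec P) → P → does P? ≡ true
    dec-true (yes _) _ = refl
    dec-true (no ¬p) p = ⊥-elim (¬p p)

    dec-witness : ∀ {P : Set} (P? : Dec P) → does P? ≡ true → P
    dec-witness (yes p) _ = p

  Span : List Vect → Subspace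
  Span L = record
    { mem      = λ v → does (inSpan? L v)
    ; 0∈       = dec-true (inSpan? L _) (∋0 (span-isSubspace L))
    ; +-closed = λ u v p q → dec-true (inSpan? L _)
        (∋-⊕ (span-isSubspace L) (dec-witness (inSpan? L u) p) (dec-witness (inSpan? L v) q))
    ; ·-closed = λ c v p → dec-true (inSpan? L _)
        (∋-· (span-isSubspace L) c (dec-witness (inSpan? L v) p)) }

  ∈Span⁺ : ∀ {L v} → InSpan L v → v ∈ₛ Span L
  ∈Span⁺ {L} {v} = dec-true (inSpan? L v)

  ∈Span⁻ : ∀ {L v} → v ∈ₛ Span L → InSpan L v
  ∈Span⁻ {L} {v} = dec-witness (inSpan? L v)

  Independent : List Vect → Set
  Independent L = ∀ cs → length cs ≡ length L → lc cs L ≡ 0v → All (_≡ 0#) cs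

  independent⇒lc≢0 : ∀ {L γ} → Independent L → length γ ≡ length L → NonTrivial γ → lc γ L ≢ 0v
  independent⇒lc≢0 {L} {γ} ind e nz z = trivial⇒¬nonTrivial (ind γ e z) nz

  independent-∷ : ∀ {L v} → Independent L → ¬ InSpan L v → Independent (v ∷ L)
  independent-∷ ind v∉ (g ∷ γ) e z with g ≟ 0#
  ... | yes refl = refl ∷ ind γ (ℕₚ.suc-injective e)
                     (trans (sym (trans (cong (_⊕ _) (·-zeroˡ _)) (⊕-identityˡ _))) z)
  ... | no g≢0 = ⊥-elim (v∉ (map ((h * - 1#) *_) γ , v∈))
    where
    h = proj₁ (inverseˡ g≢0)
    v∈ : lc (map ((h * - 1#) *_) γ) _ ≡ _
    v∈ = begin
      lc (map ((h * - 1#) *_) γ) _  ≡⟨ lc-scale _ γ _ ⟩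
      (h * - 1#) · lc γ _           ≡⟨ ·-assoc h _ _ ⟩
      h · ((- 1#) · lc γ _)         ≡⟨ cong (h ·_) (-1·v≡⊖v _) ⟩
      h · ⊖ lc γ _                  ≡⟨ cong (h ·_) (sym (inverseˡ-unique _ _ z)) ⟩
      h · (g · _)                   ≡⟨ ·-cancel (proj₂ (inverseˡ g≢0)) _ ⟩
      _                             ∎

  independent-++ˡ : ∀ A B → Independent (A ++ B) → Independent A
  independent-++ˡ A B ind cs e z = Allₚ.++⁻ˡ cs (ind (cs ++ zeros) length-eq lc≡0)
    where
    zeros = replicate (length B) 0#
    length-eq : length (cs ++ zeros) ≡ length (A ++ B)
    length-eq = begin
      length (cs ++ zeros)         ≡⟨ Lₚ.length-++ cs ⟩
      length cs ℕ.+ length zeros   ≡⟨ cong₂ ℕ._+_ e (Lₚ.length-replicate (length B)) ⟩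
      length A ℕ.+ length B        ≡⟨ sym (Lₚ.length-++ A) ⟩
      length (A ++ B)              ∎
    lc≡0 : lc (cs ++ zeros) (A ++ B) ≡ 0v
    lc≡0 = begin
      lc (cs ++ zeros) (A ++ B)  ≡⟨ lc-++ cs zeros A B e ⟩
      lc cs A ⊕ lc zeros B       ≡⟨ cong₂ _⊕_ z (lc-zeros B (Allₚ.replicate⁺ (length B) refl)) ⟩
      0v ⊕ 0v                    ≡⟨ ⊕-identityˡ 0v ⟩
      0v                         ∎

  span-disjoint : ∀ A B {v} → Independent (A ++ B) → InSpan A v → InSpan B v → v ≡ 0v
  span-disjoint A B ind (α , refl) (δ , δ≡) = begin
    lc α A   ≡⟨ sym (lc-resize α A) ⟩
    lc α′ A  ≡⟨ lc-zeros A (Allₚ.++⁻ˡ α′ (ind (α′ ++ δ′) length-eq lc≡0)) ⟩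
    0v       ∎
    where
    α′ = V.toList (resize α (length A))
    δ″ = V.toList (resize δ (length B))
    δ′ = map (- 1# *_) δ″
    length-eq : length (α′ ++ δ′) ≡ length (A ++ B)
    length-eq = begin
      length (α′ ++ δ′)        ≡⟨ Lₚ.length-++ α′ ⟩
      length α′ ℕ.+ length δ′  ≡⟨ cong₂ ℕ._+_ (length-resize α (length A))
                                           (trans (Lₚ.length-map _ δ″) (length-resize δ (length B))) ⟩
      length A ℕ.+ length B    ≡⟨ sym (Lₚ.length-++ A) ⟩
      length (A ++ B)          ∎
    lc≡0 : lc (α′ ++ δ′) (A ++ B) ≡ 0v
    lc≡0 = begin
      lc (α′ ++ δ′) (A ++ B)     ≡⟨ lc-++ α′ δ′ A B (length-resize α (length A)) ⟩
      lc α′ A ⊕ lc δ′ B          ≡⟨ cong₂ _⊕_ (lc-resize α A) (lc-scale (- 1#) δ″ B) ⟩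
      lc α A ⊕ (- 1#) · lc δ″ B  ≡⟨ cong (λ u → lc α A ⊕ (- 1#) · u) (trans (lc-resize δ B) δ≡) ⟩
      lc α A ⊕ (- 1#) · lc α A   ≡⟨ cong (lc α A ⊕_) (-1·v≡⊖v _) ⟩
      lc α A ⊕ ⊖ lc α A          ≡⟨ ⊖-inverseʳ _ ⟩
      0v                         ∎

  record Basis (U : Subspace) (L : List Vect) : Set where
    field
      ⊆U          : All (_∈ₛ U) L
      independent : Independent L
      spans       : ∀ {v} → v ∈ₛ U → InSpan L v
  open Basis public

  private
    lincomb≡lc : ∀ {d} (cs : Vec F d) (b : Vec Vect d) → lincomb cs b ≡ lc (V.toList cs) (V.toList b)
    lincomb≡lc []       []      = refl
    lincomb≡lc (c ∷ cs) (v ∷ b) = cong (c · v ⊕_) (lincomb≡lc cs b)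

    toList-allZero : ∀ {d} (cs : Vec F d) → All (_≡ 0#) (V.toList cs) → cs ≡ V.replicate d 0#
    toList-allZero []       []       = refl
    toList-allZero (c ∷ cs) (z ∷ zs) = cong₂ _∷_ z (toList-allZero cs zs)

    resize-allZero : ∀ cs d → length cs ≡ d → resize cs d ≡ V.replicate d 0# → All (_≡ 0#) cs
    resize-allZero []       zero    _ _ = []
    resize-allZero (c ∷ cs) (suc d) e z =
      proj₁ (Vₚ.∷-injective z) ∷ resize-allZero cs d (ℕₚ.suc-injective e) (proj₂ (Vₚ.∷-injective z))

  hasDim⇒basis : ∀ {U d} → HasDim U d → ∃ λ L → Basis U L × length L ≡ d
  hasDim⇒basis {U} {d} (b , b∈U , ind , span) = V.toList b , basis , Vₚ.length-toList b
    where
    L = V.toList b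
    ind′ : Independent L
    ind′ cs e z = resize-allZero cs d (trans e (Vₚ.length-toList b)) (ind (resize cs d) (begin
      lincomb (resize cs d) b            ≡⟨ lincomb≡lc (resize cs d) b ⟩
      lc (V.toList (resize cs d)) L
        ≡⟨ cong (λ k → lc (V.toList (resize cs k)) L) (sym (Vₚ.length-toList b)) ⟩
      lc (V.toList (resize cs (length L))) L ≡⟨ lc-resize cs L ⟩
      lc cs L                            ≡⟨ z ⟩
      0v                                 ∎))
    basis : Basis U L
    basis = record
      { ⊆U          = VAllₚ.toList⁺ b∈U
      ; independent = ind′
      ; spans       = λ {v} v∈U →
          let (cs , e) = span v v∈U in V.toList cs , trans (sym (lincomb≡lc cs b)) e }

  basis⇒hasDim : ∀ {U L} → Basis U L → HasDim U (length L)
  basis⇒hasDim {U} {L} B = V.fromList L , VAllₚ.fromList⁺ (⊆U B) , ind , span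
    where
    lincomb-fromList : ∀ (cs : Vec F (length L)) → lincomb cs (V.fromList L) ≡ lc (V.toList cs) L
    lincomb-fromList cs =
      trans (lincomb≡lc cs (V.fromList L)) (cong (lc (V.toList cs)) (Vₚ.toList∘fromList L))
    ind : LinIndep (V.fromList L)
    ind cs z = toList-allZero cs
      (independent B (V.toList cs) (Vₚ.length-toList cs) (trans (sym (lincomb-fromList cs)) z))
    span : ∀ v → v ∈ₛ U → ∃ λ cs → lincomb cs (V.fromList L) ≡ v
    span v v∈U with spans B v∈U
    ... | cs , refl =
      resize cs (length L) , trans (lincomb-fromList (resize cs (length L))) (lc-resize cs L)

  _+⟨_⟩ : (Vect → Set) → List Vect → Vect → Set
  (U +⟨ w ⟩) f = ∃₂ λ cs u → U u × f ≡ lc cs w ⊕ u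

  +⟨⟩-isSubspace : ∀ {U} → IsSubspace U → ∀ w → IsSubspace (U +⟨ w ⟩)
  +⟨⟩-isSubspace U w = record
    { ∋0  = [] , 0v , ∋0 U , sym (⊕-identityˡ 0v)
    ; ∋-⊕ = λ { (cs , u , u∈ , refl) (ds , u′ , u′∈ , refl) →
        cs +ᶜ ds , u ⊕ u′ , ∋-⊕ U u∈ u′∈ ,
        trans (⊕-interchange _ _ _ _) (cong (_⊕ (u ⊕ u′)) (sym (lc-+ᶜ cs ds w))) }
    ; ∋-· = λ { c (cs , u , u∈ , refl) →
        map (c *_) cs , c · u , ∋-· U c u∈ ,
        trans (·-distribˡ c _ _) (cong (_⊕ (c · u)) (sym (lc-scale c cs w))) } }

  record DependentModulo (U : Vect → Set) (L : List Vect) : Set where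
    field
      coeffs            : List F
      coeffs-length     : length coeffs ≡ length L
      coeffs-nonTrivial : NonTrivial coeffs
      lc-coeffs∈U       : U (lc coeffs L)
  open DependentModulo

  private
    Entry : Set
    Entry = F × Vect

    entry : Vect → Entry → Vect
    entry w₀ (a , r) = a · w₀ ⊕ r

    entry-0# : ∀ w₀ r → entry w₀ (0# , r) ≡ r
    entry-0# w₀ r = trans (cong (_⊕ r) (·-zeroˡ w₀)) (⊕-identityˡ r)

    peel : ∀ {U w₀ w f} → (U +⟨ w₀ ∷ w ⟩) f → ∃ λ e → (U +⟨ w ⟩) (proj₂ e) × entry w₀ e ≡ f
    peel {w₀ = w₀} {f = f} ([] , u , u∈ , e) = (0# , f) , ([] , u , u∈ , e) , entry-0# w₀ f
    peel (a ∷ cs , u , u∈ , e) = (a , lc cs _ ⊕ u) , (cs , u , u∈ , refl) , sym (trans e (⊕-assoc _ _ _))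

    peel-all : ∀ {U w₀ w L} → All (U +⟨ w₀ ∷ w ⟩) L →
               ∃ λ E → All ((U +⟨ w ⟩) ∘ proj₂) E × map (entry w₀) E ≡ L
    peel-all []         = [] , [] , refl
    peel-all (f∈ ∷ fs∈) with peel f∈ | peel-all fs∈
    ... | e , r∈ , refl | E , rs∈ , refl = e ∷ E , r∈ ∷ rs∈ , refl

    allZero-or-pivot : ∀ (E : List Entry) → All ((_≡ 0#) ∘ proj₁) E ⊎
      ∃₂ λ pre post → ∃ λ p → E ≡ pre ++ p ∷ post × proj₁ p ≢ 0#
    allZero-or-pivot []            = inj₁ []
    allZero-or-pivot ((a , r) ∷ E) with a ≟ 0# | allZero-or-pivot E
    ... | no a≢0 | _                            = inj₂ ([] , E , (a , r) , refl , a≢0)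
    ... | yes a≡0 | inj₁ zeros                  = inj₁ (a≡0 ∷ zeros)
    ... | yes _   | inj₂ (pre , post , p , refl , p≢0) = inj₂ ((a , r) ∷ pre , post , p , refl , p≢0)

    dot : List F → List F → F
    dot (g ∷ γ) (c ∷ cs) = g * c + dot γ cs
    dot _       _        = 0#

    lc-shift : ∀ {A : Set} (h : A → Vect) (k : A → F) p γ (xs : List A) →
               lc γ (map (λ x → h x ⊕ k x · p) xs) ≡ lc γ (map h xs) ⊕ dot γ (map k xs) · p
    lc-shift h k p []      xs       = sym (trans (cong (0v ⊕_) (·-zeroˡ p)) (⊕-identityˡ 0v))
    lc-shift h k p (g ∷ γ) []       = sym (trans (cong (0v ⊕_) (·-zeroˡ p)) (⊕-identityˡ 0v))
    lc-shift h k p (g ∷ γ) (x ∷ xs) = begin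
      g · (h x ⊕ k x · p) ⊕ lc γ (map (λ x → h x ⊕ k x · p) xs)
        ≡⟨ cong₂ _⊕_ (trans (·-distribˡ g _ _) (cong (g · h x ⊕_) (sym (·-assoc g (k x) p))))
                     (lc-shift h k p γ xs) ⟩
      (g · h x ⊕ (g * k x) · p) ⊕ (lc γ (map h xs) ⊕ dot γ (map k xs) · p)
        ≡⟨ ⊕-interchange _ _ _ _ ⟩
      (g · h x ⊕ lc γ (map h xs)) ⊕ ((g * k x) · p ⊕ dot γ (map k xs) · p)
        ≡⟨ cong (_ ⊕_) (sym (·-distribʳ _ _ p)) ⟩
      (g · h x ⊕ lc γ (map h xs)) ⊕ (g * k x + dot γ (map k xs)) · p  ∎

    pivot-coefficient : ∀ a {a₀ b} → b * a₀ ≡ 1# → a + - (a * b) * a₀ ≡ 0#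
    pivot-coefficient a {a₀} {b} ba₀≡1 = begin
      a + - (a * b) * a₀    ≡⟨ cong (a +_) (sym (-‿distribˡ-* (a * b) a₀)) ⟩
      a + - ((a * b) * a₀)  ≡⟨ cong (λ c → a + - c) (trans (*-assoc a b a₀) (cong (a *_) ba₀≡1)) ⟩
      a + - (a * 1#)        ≡⟨ cong (λ c → a + - c) (*-identityʳ a) ⟩
      a + - a               ≡⟨ -‿inverseʳ a ⟩
      0#                    ∎

    eliminate : ∀ {a₀ b} → b * a₀ ≡ 1# → ∀ w₀ r₀ (e : Entry) →
                entry w₀ e ⊕ (- (proj₁ e * b)) · entry w₀ (a₀ , r₀) ≡ proj₂ e ⊕ (- (proj₁ e * b)) · r₀
    eliminate {a₀} ba₀≡1 w₀ r₀ (a , r) = let k = - (a * _) in begin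
      (a · w₀ ⊕ r) ⊕ k · (a₀ · w₀ ⊕ r₀)
        ≡⟨ cong ((a · w₀ ⊕ r) ⊕_) (·-distribˡ k _ _) ⟩
      (a · w₀ ⊕ r) ⊕ (k · (a₀ · w₀) ⊕ k · r₀)
        ≡⟨ ⊕-interchange _ _ _ _ ⟩
      (a · w₀ ⊕ k · (a₀ · w₀)) ⊕ (r ⊕ k · r₀)
        ≡⟨ cong (λ u → (a · w₀ ⊕ u) ⊕ (r ⊕ k · r₀)) (sym (·-assoc k a₀ w₀)) ⟩
      (a · w₀ ⊕ (k * a₀) · w₀) ⊕ (r ⊕ k · r₀)
        ≡⟨ cong (_⊕ (r ⊕ k · r₀)) (sym (·-distribʳ a (k * a₀) w₀)) ⟩
      (a + k * a₀) · w₀ ⊕ (r ⊕ k · r₀)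
        ≡⟨ cong (λ c → entry w₀ (c , r ⊕ k · r₀)) (pivot-coefficient a ba₀≡1) ⟩
      entry w₀ (0# , r ⊕ k · r₀)
        ≡⟨ entry-0# w₀ _ ⟩
      r ⊕ k · r₀ ∎

    insert-coefficient : ∀ {U} γ d A v B → length γ ≡ length A ℕ.+ length B → NonTrivial γ →
                         U (lc γ (A ++ B) ⊕ d · v) → DependentModulo U (A ++ v ∷ B)
    insert-coefficient {U} γ d A v B γ-length nz ∈U with ++-split γ (length A) (length B) γ-length
    ... | γ₁ , γ₂ , refl , γ₁-length , γ₂-length = record
      { coeffs            = γ₁ ++ d ∷ γ₂
      ; coeffs-length     = begin
          length (γ₁ ++ d ∷ γ₂)              ≡⟨ Lₚ.length-++ γ₁ ⟩
          length γ₁ ℕ.+ suc (length γ₂)      ≡⟨ cong₂ (λ a b → a ℕ.+ suc b) γ₁-length γ₂-length ⟩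
          length A ℕ.+ suc (length B)        ≡⟨ sym (Lₚ.length-++ A) ⟩
          length (A ++ v ∷ B)                ∎
      ; coeffs-nonTrivial = [ Anyₚ.++⁺ˡ , Anyₚ.++⁺ʳ γ₁ ∘ there ]′ (Anyₚ.++⁻ γ₁ nz)
      ; lc-coeffs∈U       = subst U (sym (lc-insert γ₁ d γ₂ A v B γ₁-length)) ∈U }

    -- Gaussian elimination of w₀: subtracting multiples of the pivot entry from the others
    -- leaves pre ++ post in U +⟨ w ⟩, and a relation among those lifts to the whole list.
    pivot-step : ∀ {U w₀ w} → IsSubspace U →
      (∀ L → length w < length L → All (U +⟨ w ⟩) L → DependentModulo U L) →
      ∀ pre post a₀ r₀ → a₀ ≢ 0# → All ((U +⟨ w ⟩) ∘ proj₂) (pre ++ (a₀ , r₀) ∷ post) →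
      suc (length w) < length (map (entry w₀) (pre ++ (a₀ , r₀) ∷ post)) →
      DependentModulo U (map (entry w₀) (pre ++ (a₀ , r₀) ∷ post))
    pivot-step {U} {w₀} {w} U-sub IH pre post a₀ r₀ a₀≢0 E∈ w<E =
      subst (DependentModulo U) (sym (Lₚ.map-++ (entry w₀) pre _))
        (insert-coefficient γ D (map (entry w₀) pre) p (map (entry w₀) post)
                            γ-length (coeffs-nonTrivial rel) (subst U lc-eq (lc-coeffs∈U rel)))
      where
      ba₀≡1 = proj₂ (inverseˡ a₀≢0)
      k : Entry → F
      k (a , _) = - (a * proj₁ (inverseˡ a₀≢0))
      E = pre ++ post
      p = entry w₀ (a₀ , r₀)
      reduced : Entry → Vect
      reduced e = proj₂ e ⊕ k e · r₀

      E∈′ = Allₚ.++⁻ pre E∈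
      reduced∈ : All (U +⟨ w ⟩) (map reduced E)
      reduced∈ = Allₚ.map⁺ (All.map (λ r∈ → ∋-⊕ U′ r∈ (∋-· U′ _ (All.head (proj₂ E∈′))))
                                     (Allₚ.++⁺ (proj₁ E∈′) (All.tail (proj₂ E∈′))))
        where U′ = +⟨⟩-isSubspace U-sub w
      w<reduced : length w < length (map reduced E)
      w<reduced = ℕₚ.≤-pred (subst (suc (suc (length w)) ≤_) (begin
        length (map (entry w₀) (pre ++ (a₀ , r₀) ∷ post))  ≡⟨ Lₚ.length-map _ (pre ++ _ ∷ post) ⟩
        length (pre ++ (a₀ , r₀) ∷ post)                   ≡⟨ Lₚ.length-++-sucʳ pre _ post ⟩
        suc (length E)                                     ≡⟨ cong suc (sym (Lₚ.length-map reduced E)) ⟩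
        suc (length (map reduced E))                       ∎) w<E)

      rel = IH (map reduced E) w<reduced reduced∈
      γ = coeffs rel
      γ-length : length γ ≡ length (map (entry w₀) pre) ℕ.+ length (map (entry w₀) post)
      γ-length = begin
        length γ                 ≡⟨ trans (coeffs-length rel) (Lₚ.length-map reduced E) ⟩
        length (pre ++ post)     ≡⟨ Lₚ.length-++ pre ⟩
        length pre ℕ.+ length post
          ≡⟨ sym (cong₂ ℕ._+_ (Lₚ.length-map (entry w₀) pre) (Lₚ.length-map (entry w₀) post)) ⟩
        length (map (entry w₀) pre) ℕ.+ length (map (entry w₀) post) ∎
      D = dot γ (map k E)
      lc-eq : lc γ (map reduced E) ≡ lc γ (map (entry w₀) pre ++ map (entry w₀) post) ⊕ D · p
      lc-eq = begin
        lc γ (map reduced E)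
          ≡⟨ cong (lc γ) (sym (Lₚ.map-cong (eliminate ba₀≡1 w₀ r₀) E)) ⟩
        lc γ (map (λ e → entry w₀ e ⊕ k e · p) E)
          ≡⟨ lc-shift (entry w₀) k p γ E ⟩
        lc γ (map (entry w₀) E) ⊕ D · p
          ≡⟨ cong (λ L → lc γ L ⊕ D · p) (Lₚ.map-++ (entry w₀) pre post) ⟩
        lc γ (map (entry w₀) pre ++ map (entry w₀) post) ⊕ D · p ∎

  dependentModulo : ∀ {U} → IsSubspace U → ∀ w L → length w < length L →
                    All (U +⟨ w ⟩) L → DependentModulo U L
  dependentModulo {U} U-sub [] (f ∷ L) _ ((cs , u , u∈ , f≡) ∷ _) = record
    { coeffs            = 1# ∷ zeros
    ; coeffs-length     = cong suc (Lₚ.length-replicate (length L))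
    ; coeffs-nonTrivial = here 1≢0
    ; lc-coeffs∈U       = subst U (sym lc≡u) u∈ }
    where
    zeros = replicate (length L) 0#
    lc≡u : 1# · f ⊕ lc zeros L ≡ u
    lc≡u = begin
      1# · f ⊕ lc zeros L  ≡⟨ cong₂ _⊕_ (·-identityˡ f) (lc-zeros L (Allₚ.replicate⁺ (length L) refl)) ⟩
      f ⊕ 0v               ≡⟨ ⊕-identityʳ f ⟩
      f                    ≡⟨ f≡ ⟩
      lc cs [] ⊕ u         ≡⟨ trans (cong (_⊕ u) (lc-[] cs)) (⊕-identityˡ u) ⟩
      u                    ∎
  dependentModulo U-sub (w₀ ∷ w) L w<L L∈ with peel-all L∈
  ... | E , E∈ , refl with allZero-or-pivot E
  ... | inj₂ (pre , post , (a₀ , r₀) , refl , a₀≢0) =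
    pivot-step U-sub (dependentModulo U-sub w) pre post a₀ r₀ a₀≢0 E∈ w<L
  ... | inj₁ zeros =
    subst (DependentModulo _) (sym entries≡) (dependentModulo U-sub w (map proj₂ E) w<E (Allₚ.map⁺ E∈))
    where
    entries≡ : map (entry w₀) E ≡ map proj₂ E
    entries≡ = Lₚ.map-cong-local (All.map (λ { {_ , r} refl → entry-0# w₀ r }) zeros)
    w<E : length w < length (map proj₂ E)
    w<E = ℕₚ.<-trans (ℕₚ.n<1+n _) (subst (suc (length w) <_) (cong length entries≡) w<L)

  independent-length≤ : ∀ w L → Independent L → All (InSpan w) L → length L ≤ length w
  independent-length≤ w L ind L⊆ = ℕₚ.≮⇒≥ λ w<L →
    let rel = dependentModulo ≡0v-isSubspace w L w<L (All.map inSpan⇒mod L⊆)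
    in independent⇒lc≢0 ind (coeffs-length rel) (coeffs-nonTrivial rel) (lc-coeffs∈U rel)
    where
    ≡0v-isSubspace : IsSubspace (_≡ 0v)
    ≡0v-isSubspace = record
      { ∋0 = refl ; ∋-⊕ = λ { refl refl → ⊕-identityˡ 0v } ; ∋-· = λ { c refl → ·-zeroʳ c } }
    inSpan⇒mod : ∀ {f} → InSpan w f → ((_≡ 0v) +⟨ w ⟩) f
    inSpan⇒mod (cs , e) = cs , 0v , refl , sym (trans (⊕-identityʳ _) e)

  basis-length-unique : ∀ {U A B} → Basis U A → Basis U B → length A ≡ length B
  basis-length-unique {A = A} {B} BA BB = ℕₚ.≤-antisym
    (independent-length≤ B A (independent BA) (All.map (spans BB) (⊆U BA)))
    (independent-length≤ A B (independent BB) (All.map (spans BA) (⊆U BB)))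

  private
    extend : ∀ {X e} → All (_∈ₛ X) e → Independent e → ∀ bs → All (_∈ₛ X) bs →
             ∃ λ c → All (_∈ₛ X) c × Independent (c ++ e) × All (InSpan (c ++ e)) bs
    extend e⊆X ind []       []          = [] , [] , ind , []
    extend {X} {e} e⊆X ind (b ∷ bs) (b∈X ∷ bs⊆X) with extend {X} e⊆X ind bs bs⊆X
    ... | c , c⊆X , ind′ , bs∈ with inSpan? (c ++ e) b
    ...   | yes b∈ = c , c⊆X , ind′ , b∈ ∷ bs∈
    ...   | no  b∉ = b ∷ c , b∈X ∷ c⊆X , independent-∷ ind′ b∉ ,
                     inSpan-head b (c ++ e) ∷ All.map (inSpan-∷ b) bs∈

  extend-to-basis : ∀ {X bX e} → Basis X bX → All (_∈ₛ X) e → Independent e →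
                    ∃ λ c → Basis X (c ++ e)
  extend-to-basis {X} {bX} {e} B e⊆X ind with extend {X} e⊆X ind bX (⊆U B)
  ... | c , c⊆X , ind′ , bX∈ = c , record
    { ⊆U          = Allₚ.++⁺ c⊆X e⊆X
    ; independent = ind′
    ; spans       = λ v∈X → span-minimal (span-isSubspace (c ++ e)) bX∈ (spans B v∈X) }

  lc-split : ∀ cs A B → lc cs (A ++ B) ≡ lc (L.take (length A) cs) A ⊕ lc (L.drop (length A) cs) B
  lc-split cs       []      B = sym (⊕-identityˡ _)
  lc-split []       (v ∷ A) B = sym (⊕-identityˡ _)
  lc-split (c ∷ cs) (v ∷ A) B = trans (cong (c · v ⊕_) (lc-split cs A B)) (sym (⊕-assoc _ _ _))

  inSpan-++⇒+⟨⟩ : ∀ A B {v} → InSpan (A ++ B) v → (InSpan A +⟨ B ⟩) v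
  inSpan-++⇒+⟨⟩ A B (cs , refl) =
    L.drop (length A) cs , lc (L.take (length A) cs) A , (L.take (length A) cs , refl) ,
    trans (lc-split cs A B) (⊕-comm _ _)

  ⊆-span-∷ : ∀ {S sb} → Basis S sb → ∀ w → S ⊆ Span (w ∷ sb)
  ⊆-span-∷ BS w v v∈S = ∈Span⁺ (inSpan-∷ w (spans BS v∈S))

  span-∷-⊆ : ∀ {S sb G w} → Basis S sb → S ⊆ G → w ∈ₛ G → Span (w ∷ sb) ⊆ G
  span-∷-⊆ {G = G} BS S⊆G w∈G v v∈ =
    span-minimal (∈ₛ-isSubspace G) (w∈G ∷ All.map (S⊆G _) (⊆U BS)) (∈Span⁻ v∈)

  span-∷-basis : ∀ {S sb w} → Basis S sb → ¬ w ∈ₛ S → Basis (Span (w ∷ sb)) (w ∷ sb)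
  span-∷-basis {S} {sb} {w} BS w∉S = record
    { ⊆U          = All.map ∈Span⁺ (generators-inSpan (w ∷ sb))
    ; independent = independent-∷ (independent BS) (w∉S ∘ span-minimal (∈ₛ-isSubspace S) (⊆U BS))
    ; spans       = ∈Span⁻ }

  ∩-span-∷-basis : ∀ {X S sb e w} → Basis S sb → Basis (X ∩ S) e → w ∈ₛ X → ¬ w ∈ₛ S →
                   Basis (X ∩ Span (w ∷ sb)) (w ∷ e)
  ∩-span-∷-basis {X} {S} {sb} {e} {w} BS BE w∈X w∉S = record
    { ⊆U          = ∧-intro w∈X (∈Span⁺ (inSpan-head w sb))
                    ∷ All.map (λ p → ∧-intro (∧-left p) (⊆-span-∷ BS w _ (∧-right p))) (⊆U BE)
    ; independent = independent-∷ (independent BE)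
                      (w∉S ∘ ∧-right ∘ span-minimal (∈ₛ-isSubspace (X ∩ S)) (⊆U BE))
    ; spans       = λ v∈ → spans′ (∧-left v∈) (∈Span⁻ (∧-right v∈)) }
    where
    spans′ : ∀ {v} → v ∈ₛ X → InSpan (w ∷ sb) v → InSpan (w ∷ e) v
    spans′ v∈X ([]     , refl) = [] , refl
    spans′ v∈X (g ∷ δ , refl) = g ∷ proj₁ u∈e , cong (g · w ⊕_) (proj₂ u∈e)
      where
      u = lc δ sb
      u≡ : (g · w ⊕ u) ⊕ (- g) · w ≡ u
      u≡ = trans (cong ((g · w ⊕ u) ⊕_) (-‿·-distrib g w)) (xyx⁻¹≈y (g · w) u)
      u∈X : u ∈ₛ X
      u∈X = subst (_∈ₛ X) u≡ (+-closed X _ _ v∈X (·-closed X (- g) w w∈X))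
      u∈e = spans BE (∧-intro u∈X (span-minimal (∈ₛ-isSubspace S) (⊆U BS) (δ , refl)))

module Cover (𝔽 : FiniteField) (n : ℕ) where
  open import Data.Nat using (_+_; _*_)
  open FiniteField 𝔽 using (F; q)
  open Counting
  open Scalars 𝔽
  open Vectors 𝔽
  open Combinations 𝔽 n
  open Space 𝔽 n
    using (Vect; Subspace; _∈ₛ_; _⊆_; _∩_; ·-closed; HasDim; DimAtLeast; IsCover; _⊆?_; countContaining)

  private
    length-split : ∀ {a b x t} → a + b ≡ x → b < t → t ≤ x → a ≡ suc (x ∸ t) + (t ∸ suc b)
    length-split {a} {b} {x} {t} a+b≡x b<t t≤x = ℕₚ.+-cancelʳ-≡ b a _ (begin
      a + b                              ≡⟨ a+b≡x ⟩
      x                                  ≡⟨ sym (ℕₚ.m∸n+n≡m t≤x) ⟩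
      (x ∸ t) + t                        ≡⟨ cong ((x ∸ t) +_) (sym (ℕₚ.m+[n∸m]≡n b<t)) ⟩
      (x ∸ t) + (suc b + (t ∸ suc b))    ≡⟨ rearrange (x ∸ t) b (t ∸ suc b) ⟩
      suc (x ∸ t) + (t ∸ suc b) + b      ∎)
      where
      open ≡-Reasoning
      rearrange : ∀ k b r → k + (suc b + r) ≡ (suc k + r) + b
      rearrange = solve-∀

  complement-basis : ∀ {X S bX e t} → Basis X bX → Basis (X ∩ S) e → length e < t → t ≤ length bX →
    ∃₂ λ c₁ c₂ → Basis X (c₁ ++ c₂ ++ e) × length c₁ ≡ suc (length bX ∸ t) × length (c₂ ++ e) < t
  complement-basis {X} {S} {bX} {e} {t} BX BE e<t t≤x
    with extend-to-basis BX (All.map ∧-left (⊆U BE)) (independent BE)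
  ... | c , Bc with ++-split c (suc (length bX ∸ t)) (t ∸ suc (length e))
                      (length-split (trans (sym (Lₚ.length-++ c)) (basis-length-unique Bc BX)) e<t t≤x)
  ... | c₁ , c₂ , refl , c₁-length , c₂-length =
    c₁ , c₂ , subst (Basis X) (Lₚ.++-assoc c₁ c₂ e) Bc , c₁-length , ℕₚ.≤-reflexive (begin
      suc (length (c₂ ++ e))               ≡⟨ cong suc (Lₚ.length-++ c₂) ⟩
      suc (length c₂ + length e)           ≡⟨ cong (λ k → suc (k + length e)) c₂-length ⟩
      suc (t ∸ suc (length e) + length e)  ≡⟨ sym (ℕₚ.+-suc _ (length e)) ⟩
      t ∸ suc (length e) + suc (length e)  ≡⟨ ℕₚ.m∸n+n≡m e<t ⟩
      t                                    ∎)
    where open ≡-Reasoning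

  meets-complement : ∀ {X G c₁ Y t} → Basis X (c₁ ++ Y) → length Y < t → DimAtLeast (X ∩ G) t →
                     ∃ λ β → length β ≡ length c₁ × NonTrivial β × lc β c₁ ∈ₛ G
  meets-complement {X} {G} {c₁} {Y} BX Y<t (d , t≤d , dim) with hasDim⇒basis {X ∩ G} dim
  ... | f , Bf , refl = β , length-resize β₀ (length c₁) , nonTrivial , subst (_∈ₛ G) (sym lc-β≡w) w∈G
    where
    -- A basis f of X ∩ G has at least t > length Y vectors, so a nontrivial combination w
    -- of f lies in the span of c₁.
    rel = dependentModulo (span-isSubspace c₁) Y f (ℕₚ.<-≤-trans Y<t t≤d)
            (All.map (λ p → inSpan-++⇒+⟨⟩ c₁ Y (spans BX (∧-left p))) (⊆U Bf))
    open DependentModulo rel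
    w = lc coeffs f
    w∈G : w ∈ₛ G
    w∈G = ∋-lc (∈ₛ-isSubspace G) coeffs (All.map ∧-right (⊆U Bf))
    β₀ = proj₁ lc-coeffs∈U
    β = V.toList (resize β₀ (length c₁))
    lc-β≡w : lc β c₁ ≡ w
    lc-β≡w = trans (lc-resize β₀ c₁) (proj₂ lc-coeffs∈U)
    nonTrivial : NonTrivial β
    nonTrivial with trivial-or-nonTrivial β
    ... | inj₂ nz = nz
    ... | inj₁ zs = ⊥-elim (independent⇒lc≢0 (independent Bf) coeffs-length coeffs-nonTrivial
                                             (trans (sym lc-β≡w) (lc-zeros c₁ zs)))

  point-in : ∀ {G c₁ β} → length β ≡ length c₁ → NonTrivial β → lc β c₁ ∈ₛ G →
             Any (λ β′ → lc β′ c₁ ∈ₛ G) (points (length c₁))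
  point-in {G} {c₁} {β} β-length nz β∈G with normalise β nz
  ... | l , β′ , l≢0 , β′∈ , refl =
    subst (λ k → Any (λ β′ → lc β′ c₁ ∈ₛ G) (points k)) β-length (Any.map (λ { refl → β′∈G }) β′∈)
    where
    β′∈G : lc β′ c₁ ∈ₛ G
    β′∈G = subst (_∈ₛ G) (·-cancel (proj₂ (inverseˡ l≢0)) (lc β′ c₁))
             (·-closed G _ _ (subst (_∈ₛ G) (lc-scale l β′ c₁) β∈G))

  member-contains-point : ∀ {X S G sb c₁ Y t} → Basis S sb → Basis X (c₁ ++ Y) → length Y < t →
    DimAtLeast (X ∩ G) t → S ⊆ G → Any (λ β → Span (lc β c₁ ∷ sb) ⊆ G) (points (length c₁))
  member-contains-point {G = G} {c₁ = c₁} BS B Y<t dim S⊆G with meets-complement {G = G} B Y<t dim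
  ... | β , β-length , nz , β∈G =
    Any.map (λ {β} → span-∷-⊆ {G = G} {w = lc β c₁} BS S⊆G) (point-in {G} {c₁} β-length nz β∈G)

  complement-∉ : ∀ {X S c₁ c₂ e β} → Basis X (c₁ ++ c₂ ++ e) → Basis (X ∩ S) e →
                 length β ≡ length c₁ → NonTrivial β → ¬ lc β c₁ ∈ₛ S
  complement-∉ {X} {S} {c₁} {c₂} {e} {β} B BE β-length nz β∈S =
    independent⇒lc≢0 (independent-++ˡ c₁ (c₂ ++ e) (independent B)) β-length nz
      (span-disjoint c₁ (c₂ ++ e) (independent B) (β , refl) (inSpan-++ c₂ (spans BE (∧-intro β∈X β∈S))))
    where
    β∈X = ∋-lc (∈ₛ-isSubspace X) β (Allₚ.++⁻ˡ c₁ (⊆U B))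

  module _ {t X bX} (𝓕 : List Subspace) (cover : IsCover t X 𝓕) (BX : Basis X bX) (t≤x : t ≤ length bX)
    where

    m : ℕ
    m = suc (length bX ∸ t)

    record Enlargement (S : Subspace) (sb e : List Vect) : Set where
      field
        R         : Subspace
        w         : Vect
        S⊆R       : S ⊆ R
        basis-R   : Basis R (w ∷ sb)
        basis-X∩R : Basis (X ∩ R) (w ∷ e)
        count≤    : countContaining 𝓕 S ≤ gauss q m 1 * countContaining 𝓕 R

    -- Among the spaces ⟨w, S⟩ for w a point of ⟨c₁⟩, which together contain every member
    -- of 𝓕 containing S, take one contained in the most members.
    enlarge : ∀ {S sb e} → Basis S sb → Basis (X ∩ S) e → length e < t → Enlargement S sb e
    enlarge {S} {sb} {e} BS BE e<t with complement-basis {S = S} BX BE e<t t≤x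
    ... | c₁ , c₂ , B , c₁-length , Y<t = record
      { R         = R β*
      ; w         = lc β* c₁
      ; S⊆R       = ⊆-span-∷ BS _
      ; basis-R   = span-∷-basis BS w∉S
      ; basis-X∩R = ∩-span-∷-basis {X} {S} BS BE w∈X w∉S
      ; count≤    = count≤ }
      where
      R : List F → Subspace
      R β = Span (lc β c₁ ∷ sb)
      count : List F → ℕ
      count β = countContaining 𝓕 (R β)
      covered : All (λ G → S ⊆ G → Any (λ β → R β ⊆ G) (points m)) 𝓕
      covered = All.map (λ {G} dim → subst (λ k → Any (λ β → R β ⊆ G) (points k)) c₁-length
                                     ∘ member-contains-point {G = G} BS B Y<t dim) cover
      max = sum-map-≤-length*max count (points-nonTrivial m) (s≤s z≤n)
      β* = proj₁ max
      w∉S = complement-∉ {S = S} B BE (trans (proj₁ (proj₁ (proj₂ max))) (sym c₁-length))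
                                       (proj₂ (proj₁ (proj₂ max)))
      w∈X = ∋-lc (∈ₛ-isSubspace X) β* (Allₚ.++⁻ˡ c₁ (⊆U B))
      count≤ : countContaining 𝓕 S ≤ gauss q m 1 * count β*
      count≤ = begin
        countContaining 𝓕 S           ≤⟨ double-counting (S ⊆?_) (λ β → R β ⊆?_) (points m) 𝓕 covered ⟩
        sum (map count (points m))     ≤⟨ proj₂ (proj₂ max) ⟩
        length (points m) * count β*   ≡⟨ cong (_* count β*) (length-points m) ⟩
        gauss q m 1 * count β*         ∎
        where open ℕₚ.≤-Reasoning

    enlarge-iteratively : ∀ j {S sb e} → Basis S sb → Basis (X ∩ S) e → length e + j ≡ t →
      ∃₂ λ R rb → Basis R rb × length rb ≡ length sb + j × S ⊆ R ×
                  countContaining 𝓕 S ≤ gauss q m 1 ^ j * countContaining 𝓕 R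
    enlarge-iteratively zero    BS BE _ =
      _ , _ , BS , sym (ℕₚ.+-identityʳ _) , (λ _ v∈ → v∈) , ℕₚ.≤-reflexive (sym (ℕₚ.*-identityˡ _))
    enlarge-iteratively (suc j) {S} {sb} {e} BS BE e+j≡t
      with enlarge BS BE (subst (length e <_) e+j≡t (ℕₚ.m<m+n _ (s≤s z≤n)))
    ... | E with enlarge-iteratively j (Enlargement.basis-R E) (Enlargement.basis-X∩R E)
                                      (trans (sym (ℕₚ.+-suc _ j)) e+j≡t)
    ...   | R , rb , BR , rb-length , R′⊆R , count≤ =
      R , rb , BR , trans rb-length (sym (ℕₚ.+-suc _ j)) , (λ v → R′⊆R v ∘ Enlargement.S⊆R E v) , (begin
        countContaining 𝓕 S                                 ≤⟨ Enlargement.count≤ E ⟩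
        g * countContaining 𝓕 (Enlargement.R E)             ≤⟨ ℕₚ.*-monoʳ-≤ g count≤ ⟩
        g * (g ^ j * countContaining 𝓕 R)                   ≡⟨ sym (ℕₚ.*-assoc g (g ^ j) _) ⟩
        g ^ suc j * countContaining 𝓕 R                     ∎)
      where
      open ℕₚ.≤-Reasoning
      g = gauss q m 1

  enlargement-bound : ∀ {t x s y X S} (𝓕 : List Subspace) → IsCover t X 𝓕 → HasDim X x → t ≤ x →
    HasDim S s → HasDim (X ∩ S) y → y < t →
    ∃[ R ] (HasDim R (s + (t ∸ y)) × S ⊆ R ×
      countContaining 𝓕 S ≤ gauss q ((x ∸ t) + 1) 1 ^ (t ∸ y) * countContaining 𝓕 R)
  enlargement-bound {t} {X = X} {S} 𝓕 cover dimX t≤x dimS dimX∩S y<t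
    with hasDim⇒basis {X} dimX | hasDim⇒basis {S} dimS | hasDim⇒basis {X ∩ S} dimX∩S
  ... | bX , BX , refl | sb , BS , refl | e , BE , refl
    with enlarge-iteratively 𝓕 cover BX t≤x (t ∸ length e) {S} BS BE (ℕₚ.m+[n∸m]≡n (ℕₚ.<⇒≤ y<t))
  ... | R , rb , BR , rb-length , S⊆R , count≤ =
    R , subst (HasDim R) rb-length (basis⇒hasDim BR) , S⊆R ,
    subst (λ k → countContaining 𝓕 S ≤ gauss q k 1 ^ (t ∸ length e) * countContaining 𝓕 R)
          (ℕₚ.+-comm 1 (length bX ∸ t)) count≤

open import Data.Nat using (_+_; _*_)

lemma2p2 : (𝔽 : FiniteField) (n k x s t : ℕ) →
    1 ≤ n → 1 ≤ k → 1 ≤ x → 1 ≤ s → 1 ≤ t →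
    k + x ≤ n → t ≤ k → t ≤ x →
    let open FiniteField 𝔽 using (q) in
    let open Space 𝔽 n in
    (𝓕 : List Subspace) → Distinct 𝓕 → All (λ G → HasDim G k) 𝓕 →
    (X : Subspace) → HasDim X x → IsCover t X 𝓕 →
    (S : Subspace) → HasDim S s →
    (y : ℕ) → HasDim (X ∩ S) y → y < t →
    ∃[ R ] (HasDim R (s + (t ∸ y)) × S ⊆ R ×
      countContaining 𝓕 S ≤ gauss q ((x ∸ t) + 1) 1 ^ (t ∸ y) * countContaining 𝓕 R)
lemma2p2 𝔽 n k x s t _ _ _ _ _ _ _ t≤x 𝓕 _ _ X dimX cover S dimS y dimX∩S y<t =
  Cover.enlargement-bound 𝔽 n {X = X} {S} 𝓕 cover dimX t≤x dimS dimX∩S y<t
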